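{- For any finite signature $\Sigma$ and any total-closed set $S\subseteq\mathcal I$, $\big((\mathcal I\setminus S)_c\big)\downarrow\subseteq\mathcal I\setminus S$.
   Context: $\Sigma$ is a finite set of atoms. A partial interpretation is a map $v:\Sigma\to\{0,1,2\}$; $\mathcal I$ is the set of all of them and $\mathcal I_c$ the set of classical ones (no atom mapped to $1$). For $v\in\mathcal I$, $v_t\in\mathcal I_c$ is defined by $v_t(p)=2$ if $v(p)=1$ and $v_t(p)=v(p)$ otherwise. A set $S\subseteq\mathcal I$ is total-closed iff for every $v\in S$ also $v_t\in S$. The order on $\mathcal I$: $u\le v$ iff for every atom $p$, $u(p)\le v(p)$ and ($u(p)=0$ implies $v(p)=0$). For $S\subseteq\mathcal I$: $S_c=S\cap\mathcal I_c$; $S\downarrow=\{u\in\mathcal I:\exists v\in S,\ v\ge u\}$. -}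

module Defs where

open import Level using (Level; suc)
open import Data.Nat using (ℕ)
open import Data.Fin using (Fin)
open import Data.Vec using (Vec; lookup; map)
open import Data.Product using (Σ-syntax; _×_)
open import Relation.Nullary using (¬_)
open import Relation.Binary.PropositionalEquality using (_≡_)

-- Truth values 0, 1, 2 (1 = undefined/partial).
data V3 : Set where
  v0 v1 v2 : V3

data _≤₃_ : V3 → V3 → Set where
  0≤0 : v0 ≤₃ v0
  0≤1 : v0 ≤₃ v1
  0≤2 : v0 ≤₃ v2
  1≤1 : v1 ≤₃ v1
  1≤2 : v1 ≤₃ v2
  2≤2 : v2 ≤₃ v2

-- Finite signature Σ = Fin n; partial interpretations Σ → {0,1,2}.
-- Represented as a vector (finite function Fin n → V3) so that equality of
-- interpretations is the structural one.
Interp : ℕ → Set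
Interp n = Vec V3 n

Classical : ∀ {n} → Interp n → Set
Classical v = ∀ p → ¬ (lookup v p ≡ v1)

tot₃ : V3 → V3
tot₃ v0 = v0
tot₃ v1 = v2
tot₃ v2 = v2

total : ∀ {n} → Interp n → Interp n
total v = map tot₃ v

ISet : ℕ → Set₁
ISet n = Interp n → Set

TotalClosed : ∀ {n} → ISet n → Set
TotalClosed S = ∀ v → S v → S (total v)

_≼_ : ∀ {n} → Interp n → Interp n → Set
u ≼ v = ∀ p → (lookup u p ≤₃ lookup v p) × (lookup u p ≡ v0 → lookup v p ≡ v0)

Compl : ∀ {n} → ISet n → ISet n
Compl S v = ¬ S v

ClassicalPart : ∀ {n} → ISet n → ISet n
ClassicalPart S v = S v × Classical v

Down : ∀ {n} → ISet n → ISet n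
Down S u = Σ[ v ∈ Interp _ ] (S v × (u ≼ v))

_⊆_ : ∀ {n} → ISet n → ISet n → Set
A ⊆ B = ∀ v → A v → B v

module Submission where

open import Data.Nat using (ℕ)
open import Data.Fin using (zero; suc)
open import Data.Vec using ([]; _∷_)
open import Data.Product using (_,_)
open import Data.Empty using (⊥-elim)
open import Relation.Nullary using (¬_)
open import Relation.Binary.PropositionalEquality using (_≡_; refl; cong₂; subst)
open import Defs

-- The only classical interpretation above u is u_t: the order keeps 0 fixed, and
-- the only classical value above 1 is 2.  So if u ∈ S lay below a classical v ∉ S,
-- total-closedness would put v = u_t into S.

tot₃-≤₃-classical : ∀ a b → a ≤₃ b → (a ≡ v0 → b ≡ v0) → ¬ b ≡ v1 → tot₃ a ≡ b
tot₃-≤₃-classical v0 v0 0≤0 _ _ = refl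
tot₃-≤₃-classical v0 v1 0≤1 _ b≢1 = ⊥-elim (b≢1 refl)
tot₃-≤₃-classical v0 v2 0≤2 zero-kept _ with zero-kept refl
... | ()
tot₃-≤₃-classical v1 v1 1≤1 _ b≢1 = ⊥-elim (b≢1 refl)
tot₃-≤₃-classical v1 v2 1≤2 _ _ = refl
tot₃-≤₃-classical v2 v2 2≤2 _ _ = refl

total-≼-classical : ∀ {n} (u v : Interp n) → u ≼ v → Classical v → total u ≡ v
total-≼-classical [] [] _ _ = refl
total-≼-classical (a ∷ u) (b ∷ v) u≼v cl-v with u≼v zero
... | a≤b , zero-kept =
  cong₂ _∷_ (tot₃-≤₃-classical a b a≤b zero-kept (cl-v zero))
            (total-≼-classical u v (λ p → u≼v (suc p)) (λ p → cl-v (suc p)))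

proposition4 : (n : ℕ) (S : ISet n) → TotalClosed S →
    Down (ClassicalPart (Compl S)) ⊆ Compl S
proposition4 n S closed u (v , (v∉S , cl-v) , u≼v) u∈S =
  v∉S (subst S (total-≼-classical u v u≼v cl-v) (closed u u∈S))
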